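{- Let $k$ and $r$ be positive integers with $k\geq 2$ and $1\leq r<k-1$, let $D$ be the diameter of $K(2k+r,k)$, and let $p\geq1$ be an integer with $2p\leq D$ such that $2p<D$ or $r$ divides $k-1$. If $A$ and $B$ are vertices of $K_{=2p}(2k+r,k)$, then their distance in $K_{=2p}(2k+r,k)$ is at least $\frac{k-|A\cap B|}{rp}$.
   Context: For positive integers $n,k$, $[n]^k$ is the set of $k$-element subsets of $\{1,\dots,n\}$. The Kneser graph $K(2k+r,k)$ has vertex set $[2k+r]^k$, with $A,B$ adjacent iff $A\cap B=\emptyset$; it is connected. For a connected graph $G$ and positive integer $d$, the exact distance-$d$ graph $G_{=d}$ has the same vertex set as $G$, with two vertices adjacent iff their distance in $G$ is exactly $d$. $K_{=d}(2k+r,k)$ denotes the exact distance-$d$ graph of $K(2k+r,k)$. (The diameter of $K(2k+r,k)$ is $\lceil (k-1)/r\rceil+1$.) -}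

module Defs where

open import Data.Nat using (ℕ; zero; suc; _+_; _∸_; _<_; _/_)
open import Data.Fin.Subset using (Subset; ⊥; _∩_; ∣_∣)
open import Data.Product using (Σ; _×_; _,_)
open import Relation.Binary.PropositionalEquality using (_≡_)
open import Relation.Nullary using (¬_)

KVertex : ℕ → ℕ → Set
KVertex n k = Σ (Subset n) (λ A → ∣ A ∣ ≡ k)

KAdj : ∀ {n k} → KVertex n k → KVertex n k → Set
KAdj (A , _) (B , _) = A ∩ B ≡ ⊥

data Walk {V : Set} (Adj : V → V → Set) : V → V → ℕ → Set where
  here : ∀ {u} → Walk Adj u u zero
  step : ∀ {u v w m} → Adj u v → Walk Adj v w m → Walk Adj u w (suc m)

DistEq : {V : Set} → (V → V → Set) → V → V → ℕ → Set
DistEq Adj u v d = Walk Adj u v d × (∀ m → m < d → ¬ Walk Adj u v m)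

ExactDist : {V : Set} → (V → V → Set) → ℕ → V → V → Set
ExactDist Adj d u v = DistEq Adj u v d

-- Ceiling division ⌈a / b⌉ (b ≥ 1; value for b = 0 irrelevant).
ceilDiv : ℕ → ℕ → ℕ
ceilDiv a zero = zero
ceilDiv a (suc b) = (a + b) / suc b

-- Diameter of K(2k+r,k), as given in the context: ⌈(k-1)/r⌉ + 1.
kneserDiam : ℕ → ℕ → ℕ
kneserDiam k r = ceilDiv (k ∸ 1) r + 1

interSize : ∀ {n k} → KVertex n k → KVertex n k → ℕ
interSize (A , _) (B , _) = ∣ A ∩ B ∣

{-# OPTIONS --safe #-}
-- Put δ(A, B) = k − |A ∩ B|.  It satisfies the triangle inequality, and two
-- Kneser steps A — X — Y change it by at most r: A, Y are both disjoint from X,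
-- so |A ∪ Y| ≤ (2k + r) − k, i.e. |A ∩ Y| ≥ k − r.  Hence a walk of length 2p
-- moves δ by at most rp, and a walk of m such edges of the exact distance-2p
-- graph moves it by at most m·rp.
module Submission where

open import Defs
open import Data.Nat using (ℕ; zero; suc; _+_; _*_; _∸_; _≤_; _<_)
open import Data.Nat.Divisibility using (_∣_)
open import Data.Nat.Properties
open import Data.Nat.Tactic.RingSolver using (solve-∀)
open import Data.Fin.Subset using (Subset; _∩_; _∪_; _⊆_; ∣_∣; inside; outside)
  renaming (⊥ to ∅)
open import Data.Fin.Subset.Properties
  using (∩-comm; ∩-idem; ∩-distribˡ-∪; ∩-distribʳ-∪; ∪-identityˡ; ∣⊥∣≡0; ∣p∣≤n;
         ∣p∩q∣≤∣p∣; p⊆q⇒∣p∣≤∣q∣; x∈p∩q⁺; x∈p∩q⁻)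
open import Data.Product using (_,_; proj₂)
open import Data.Sum using (_⊎_)
open import Data.Vec using ([]; _∷_)
open import Relation.Binary.PropositionalEquality

∣p∪q∣+∣p∩q∣≡∣p∣+∣q∣ : ∀ {n} (p q : Subset n) → ∣ p ∪ q ∣ + ∣ p ∩ q ∣ ≡ ∣ p ∣ + ∣ q ∣
∣p∪q∣+∣p∩q∣≡∣p∣+∣q∣ []            []            = refl
∣p∪q∣+∣p∩q∣≡∣p∣+∣q∣ (outside ∷ p) (outside ∷ q) = ∣p∪q∣+∣p∩q∣≡∣p∣+∣q∣ p q
∣p∪q∣+∣p∩q∣≡∣p∣+∣q∣ (inside  ∷ p) (outside ∷ q) = cong suc (∣p∪q∣+∣p∩q∣≡∣p∣+∣q∣ p q)
∣p∪q∣+∣p∩q∣≡∣p∣+∣q∣ (outside ∷ p) (inside  ∷ q) =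
  trans (cong suc (∣p∪q∣+∣p∩q∣≡∣p∣+∣q∣ p q)) (sym (+-suc ∣ p ∣ ∣ q ∣))
∣p∪q∣+∣p∩q∣≡∣p∣+∣q∣ (inside  ∷ p) (inside  ∷ q) = cong suc (begin
  ∣ p ∪ q ∣ + suc ∣ p ∩ q ∣ ≡⟨ +-suc ∣ p ∪ q ∣ ∣ p ∩ q ∣ ⟩
  suc (∣ p ∪ q ∣ + ∣ p ∩ q ∣) ≡⟨ cong suc (∣p∪q∣+∣p∩q∣≡∣p∣+∣q∣ p q) ⟩
  suc (∣ p ∣ + ∣ q ∣)         ≡⟨ +-suc ∣ p ∣ ∣ q ∣ ⟨
  ∣ p ∣ + suc ∣ q ∣           ∎)
  where open ≡-Reasoning

p∩q≡∅⇒∣p∣+∣q∣≤n : ∀ {n} (p q : Subset n) → p ∩ q ≡ ∅ → ∣ p ∣ + ∣ q ∣ ≤ n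
p∩q≡∅⇒∣p∣+∣q∣≤n {n} p q p∩q≡∅ = begin
  ∣ p ∣ + ∣ q ∣             ≡⟨ ∣p∪q∣+∣p∩q∣≡∣p∣+∣q∣ p q ⟨
  ∣ p ∪ q ∣ + ∣ p ∩ q ∣     ≡⟨ cong (λ s → ∣ p ∪ q ∣ + ∣ s ∣) p∩q≡∅ ⟩
  ∣ p ∪ q ∣ + ∣ ∅ {n = n} ∣ ≡⟨ cong (∣ p ∪ q ∣ +_) (∣⊥∣≡0 n) ⟩
  ∣ p ∪ q ∣ + 0             ≡⟨ +-identityʳ _ ⟩
  ∣ p ∪ q ∣                 ≤⟨ ∣p∣≤n (p ∪ q) ⟩
  n                         ∎
  where open ≤-Reasoning

p∩r≡∅⇒q∩r≡∅⇒[p∪q]∩r≡∅ : ∀ {n} (p q r : Subset n) → p ∩ r ≡ ∅ → q ∩ r ≡ ∅ → (p ∪ q) ∩ r ≡ ∅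
p∩r≡∅⇒q∩r≡∅⇒[p∪q]∩r≡∅ p q r p∩r≡∅ q∩r≡∅ = begin
  (p ∪ q) ∩ r        ≡⟨ ∩-distribʳ-∪ r p q ⟩
  (p ∩ r) ∪ (q ∩ r)  ≡⟨ cong₂ _∪_ p∩r≡∅ q∩r≡∅ ⟩
  ∅ ∪ ∅              ≡⟨ ∪-identityˡ ∅ ⟩
  ∅                  ∎
  where open ≡-Reasoning

∣p∩q∣+∣q∩r∣≤∣p∩r∣+∣q∣ : ∀ {n} (p q r : Subset n) → ∣ p ∩ q ∣ + ∣ q ∩ r ∣ ≤ ∣ p ∩ r ∣ + ∣ q ∣
∣p∩q∣+∣q∩r∣≤∣p∩r∣+∣q∣ p q r = begin
  ∣ p ∩ q ∣ + ∣ q ∩ r ∣                             ≡⟨ cong (λ s → ∣ s ∣ + ∣ q ∩ r ∣) (∩-comm p q) ⟩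
  ∣ q ∩ p ∣ + ∣ q ∩ r ∣                             ≡⟨ ∣p∪q∣+∣p∩q∣≡∣p∣+∣q∣ (q ∩ p) (q ∩ r) ⟨
  ∣ (q ∩ p) ∪ (q ∩ r) ∣ + ∣ (q ∩ p) ∩ (q ∩ r) ∣     ≡⟨ cong (λ s → ∣ s ∣ + ∣ (q ∩ p) ∩ (q ∩ r) ∣) (∩-distribˡ-∪ q p r) ⟨
  ∣ q ∩ (p ∪ r) ∣ + ∣ (q ∩ p) ∩ (q ∩ r) ∣           ≤⟨ +-mono-≤ (∣p∩q∣≤∣p∣ q (p ∪ r)) (p⊆q⇒∣p∣≤∣q∣ common⊆p∩r) ⟩
  ∣ q ∣ + ∣ p ∩ r ∣                                 ≡⟨ +-comm ∣ q ∣ _ ⟩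
  ∣ p ∩ r ∣ + ∣ q ∣                                 ∎
  where
  open ≤-Reasoning
  common⊆p∩r : (q ∩ p) ∩ (q ∩ r) ⊆ p ∩ r
  common⊆p∩r x∈ with x∈p∩q⁻ (q ∩ p) (q ∩ r) x∈
  ... | x∈q∩p , x∈q∩r = x∈p∩q⁺ (proj₂ (x∈p∩q⁻ q p x∈q∩p) , proj₂ (x∈p∩q⁻ q r x∈q∩r))

k∸z≤[k∸x]+[k∸y] : ∀ x y z k → x + y ≤ z + k → k ∸ z ≤ (k ∸ x) + (k ∸ y)
k∸z≤[k∸x]+[k∸y] x y z k x+y≤z+k = m≤n+o⇒m∸n≤o k z (+-cancelˡ-≤ k _ _ (begin
  k + k                           ≤⟨ +-mono-≤ (m≤n+m∸n k x) (m≤n+m∸n k y) ⟩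
  (x + (k ∸ x)) + (y + (k ∸ y))   ≡⟨ regroup x (k ∸ x) y (k ∸ y) ⟩
  (x + y) + ((k ∸ x) + (k ∸ y))   ≤⟨ +-monoˡ-≤ _ x+y≤z+k ⟩
  (z + k) + ((k ∸ x) + (k ∸ y))   ≡⟨ regroup′ z k _ ⟩
  k + (z + ((k ∸ x) + (k ∸ y)))   ∎))
  where
  open ≤-Reasoning
  regroup : ∀ a b c d → (a + b) + (c + d) ≡ (a + c) + (b + d)
  regroup = solve-∀
  regroup′ : ∀ a b c → (a + b) + c ≡ b + (a + c)
  regroup′ = solve-∀

data _² {V : Set} (Adj : V → V → Set) (u w : V) : Set where
  two-step : ∀ {v} → Adj u v → Adj v w → (Adj ²) u w

walk-halve : ∀ {V : Set} {Adj : V → V → Set} {u v} p →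
             Walk Adj u v (2 * p) → Walk (Adj ²) u v p
walk-halve zero    here = here
walk-halve (suc p) w with subst (Walk _ _ _) (*-suc 2 p) w
... | step uX (step XY w′) = step (two-step uX XY) (walk-halve p w′)

module _ {V : Set} (d : V → V → ℕ)
         (d-refl : ∀ u → d u u ≡ 0)
         (d-triangle : ∀ u v w → d u w ≤ d u v + d v w) where

  walk⇒d≤m*c : ∀ {Adj : V → V → Set} {c} → (∀ {u v} → Adj u v → d u v ≤ c) →
               ∀ {u v m} → Walk Adj u v m → d u v ≤ m * c
  walk⇒d≤m*c edge-bound here = ≤-reflexive (d-refl _)
  walk⇒d≤m*c edge-bound (step uv w) =
    ≤-trans (d-triangle _ _ _) (+-mono-≤ (edge-bound uv) (walk⇒d≤m*c edge-bound w))

module _ {n k : ℕ} where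

  δ : KVertex n k → KVertex n k → ℕ
  δ A B = k ∸ interSize A B

  δ-refl : ∀ A → δ A A ≡ 0
  δ-refl (a , ∣a∣≡k) rewrite ∩-idem a | ∣a∣≡k = n∸n≡0 k

  δ-triangle : ∀ A B C → δ A C ≤ δ A B + δ B C
  δ-triangle (a , _) (b , ∣b∣≡k) (c , _) =
    k∸z≤[k∸x]+[k∸y] (∣ a ∩ b ∣) (∣ b ∩ c ∣) (∣ a ∩ c ∣) k
      (subst (λ s → ∣ a ∩ b ∣ + ∣ b ∩ c ∣ ≤ ∣ a ∩ c ∣ + s) ∣b∣≡k (∣p∩q∣+∣q∩r∣≤∣p∩r∣+∣q∣ a b c))

δ-two-steps≤r : ∀ k r {A Y : KVertex (2 * k + r) k} → (KAdj ²) A Y → δ A Y ≤ r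
δ-two-steps≤r k r {a , ∣a∣≡k} {y , ∣y∣≡k} (two-step {x , ∣x∣≡k} a∩x≡∅ x∩y≡∅) =
  m≤n+o⇒m∸n≤o k (∣ a ∩ y ∣) (+-cancelˡ-≤ (k + k) _ _ (begin
    k + k + k                          ≡⟨ cong₂ (λ s t → s + t + k) ∣a∣≡k ∣y∣≡k ⟨
    ∣ a ∣ + ∣ y ∣ + k                  ≡⟨ cong (_+ k) (∣p∪q∣+∣p∩q∣≡∣p∣+∣q∣ a y) ⟨
    ∣ a ∪ y ∣ + ∣ a ∩ y ∣ + k          ≡⟨ shuffle (∣ a ∪ y ∣) (∣ a ∩ y ∣) k ⟩
    (∣ a ∪ y ∣ + k) + ∣ a ∩ y ∣        ≤⟨ +-monoˡ-≤ _ a∪y+x≤n ⟩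
    (2 * k + r) + ∣ a ∩ y ∣            ≡⟨ shuffle′ k r (∣ a ∩ y ∣) ⟩
    k + k + (∣ a ∩ y ∣ + r)            ∎))
  where
  open ≤-Reasoning
  shuffle : ∀ s t u → s + t + u ≡ (s + u) + t
  shuffle = solve-∀
  shuffle′ : ∀ s t u → 2 * s + t + u ≡ s + s + (u + t)
  shuffle′ = solve-∀
  a∪y+x≤n : ∣ a ∪ y ∣ + k ≤ 2 * k + r
  a∪y+x≤n = subst (λ s → ∣ a ∪ y ∣ + s ≤ 2 * k + r) ∣x∣≡k (p∩q≡∅⇒∣p∣+∣q∣≤n (a ∪ y) x
    (p∩r≡∅⇒q∩r≡∅⇒[p∪q]∩r≡∅ a y x a∩x≡∅ (trans (∩-comm y x) x∩y≡∅)))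

mainTheorem9 : (k r p : ℕ) → 2 ≤ k → 1 ≤ r → r < k ∸ 1 → 1 ≤ p →
    2 * p ≤ kneserDiam k r →
    (2 * p < kneserDiam k r ⊎ r ∣ (k ∸ 1)) →
    (A B : KVertex (2 * k + r) k) →
    ∀ m → Walk (ExactDist KAdj (2 * p)) A B m →
    k ∸ interSize A B ≤ m * (r * p)
mainTheorem9 k r p _ _ _ _ _ _ A B m walk = walk⇒d≤m*c δ δ-refl δ-triangle exact-2p-step≤rp walk
  where
  exact-2p-step≤rp : ∀ {C D : KVertex (2 * k + r) k} → ExactDist KAdj (2 * p) C D → δ C D ≤ r * p
  exact-2p-step≤rp {C} {D} (walk-2p , _) =
    subst (δ C D ≤_) (*-comm p r)
      (walk⇒d≤m*c δ δ-refl δ-triangle (δ-two-steps≤r k r) (walk-halve p walk-2p))
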